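{- Let $p$ be an odd prime and $r\geq1$ an integer. Then $$\sum_{x=0}^{p^r-1}\Big\{\frac{x^2}{p^r}\Big\}=\frac12\Big(p^r-p^{\lfloor r/2\rfloor}\Big)-\frac{p^{\lfloor (r+1)/2\rfloor}-1}{p-1}\,h_p^\ast,$$ where $h_p^\ast=-\sum_{a=0}^{p-1}\left(\frac{a}{p}\right)\frac{a}{p}$.
   Context: For $x\in\mathbb{Q}$, $\{x\}\in[0,1)$ denotes the fractional part of $x$. $\left(\frac{a}{p}\right)$ is the Legendre symbol. -}

module Defs where

open import Data.Nat as ℕ using (ℕ; suc; _^_; _%_)
open import Data.Nat.Divisibility using (_∣?_)
open import Data.Integer as ℤ using (ℤ; +_; -[1+_])
open import Data.Rational as ℚ using (ℚ; floor; _-_; _+_; _/_)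
open import Data.List using (List; foldr; map; upTo)
open import Data.Bool using (Bool; true; false; if_then_else_)
open import Data.Nat.Primality using (Prime)
open import Relation.Nullary.Decidable using (does)
open import Data.List.Relation.Unary.Any using (any?)

frac : ℚ → ℚ
frac q = q - (floor q / 1)

sumℚ : List ℚ → ℚ
sumℚ = foldr _+_ ℚ.0ℚ

Σ< : ℕ → (ℕ → ℚ) → ℚ
Σ< n f = sumℚ (map f (upTo n))

isSquareMod : (p : ℕ) → .{{_ : ℕ.NonZero p}} → ℕ → Bool
isSquareMod p a = does (any? (λ y → (y ℕ.* y) % p ℕ.≟ a % p) (upTo p))

legendre : ℕ → (p : ℕ) → .{{_ : ℕ.NonZero p}} → ℤ
legendre a p =
  if does (p ∣? a) then + 0
  else if isSquareMod p a then + 1 else -[1+ 0 ]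

hstar : (p : ℕ) → .{{_ : ℕ.NonZero p}} → ℚ
hstar p = ℚ.- Σ< p (λ a → (legendre a p ℤ.* + a) / p)

{-# OPTIONS --safe #-}
module Submission where

-- Let S(r) = Σ_{x < p^r} (x² mod p^r), so the left-hand side is S(r)/p^r, and let U(r) be the
-- same sum over the units x. A multiple x = tp has (tp)² mod p^(r+2) = p²·(t² mod p^r), so
-- S(r+2) = U(r+2) + p³·S(r). A unit y mod p^(s+1) has the p lifts y + t·p^(s+1), whose squares
-- mod p^(s+2) are y² + 2yt·p^(s+1); since p is odd the top digit runs over all residues mod p,
-- so U(s+2) = p·U(s+1) + p^(s+1)·(p(p−1)/2)·φ(p^(s+1)). At the bottom, U(1) = S(1) = Σ_a a·#{y : y² ≡ a}
-- = Σ_a a·(1 + (a/p)). Solving the two recursions gives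
-- 2p(p−1)·S(r) = p(p−1)·p^r·(p^r − p^⌊r/2⌋) + 2p^r·(p^⌊(r+1)/2⌋ − 1)·Σ_a (a/p)·a,
-- which is the claim since Σ_a (a/p)·a = −p·h*_p.

open import Algebra.Bundles using (CommutativeMonoid)
open import Algebra.Core using (Op₂)
open import Algebra.Structures using (IsCommutativeMonoid)
open import Data.Bool using (if_then_else_)
open import Data.Empty using (⊥-elim)
open import Data.List using (upTo; applyUpTo; map)
open import Data.List.Membership.Propositional using (find; lose)
open import Data.List.Membership.Propositional.Properties using (∈-upTo⁺; ∈-upTo⁻)
open import Data.List.Relation.Unary.Any using (Any; any?)
open import Data.Nat as ℕ using (ℕ; zero; suc; _^_; _≤_; _<_; _/_; _∸_; _≟_; NonZero; z≤n; s≤s; z<s; nonTrivial⇒n>1)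
open import Data.Nat.DivMod
open import Data.Nat.Divisibility using (_∣_; _∣?_; divides; ∣⇒≤; m%n≡0⇒n∣m; n∣m*n; m∣m*n; ∣m+n∣m⇒∣n; ∣m∣n⇒∣m+n; ∣n⇒∣m*n)
open import Data.Nat.GCD using (gcd; gcd[m,n]≢0; n/gcd[m,n]≢0)
open import Data.Nat.Primality using (Prime; euclidsLemma; prime⇒nonZero; prime⇒nonTrivial; prime⇒irreducible)
open import Data.Nat.Properties as ℕP
import Data.Nat.Tactic.RingSolver as ℕ-Solver
import Data.Integer as ℤ
import Data.Integer.Properties as ℤP
import Data.Integer.Tactic.RingSolver as ℤ-Solver
open import Data.Product using (_×_; _,_)
open import Data.Rational as ℚ using (ℚ; toℚᵘ)
import Data.Rational.Properties as ℚP
import Data.Rational.Unnormalised as ℚᵘ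
import Data.Rational.Unnormalised.Properties as ℚᵘP
open import Data.Sum using (_⊎_; inj₁; inj₂)
open import Defs
open import Function using (_∘_; id; _⇔_; mk⇔; Equivalence)
open import Level using (0ℓ)
open import Relation.Binary.PropositionalEquality
open import Relation.Nullary using (Dec; yes; no; does; ¬_; ¬?)
open import Relation.Nullary.Decidable using (dec-true; dec-false; _⊎-dec_)

module FiniteSum {A : Set} {_∙_ : Op₂ A} {ε : A} (isCM : IsCommutativeMonoid _≡_ _∙_ ε) where

  open import Data.Nat using (_+_; _*_)
  open IsCommutativeMonoid isCM using (assoc; identityʳ)

  commutativeMonoid : CommutativeMonoid 0ℓ 0ℓ
  commutativeMonoid = record { isCommutativeMonoid = isCM }

  open import Algebra.Properties.CommutativeSemigroup (CommutativeMonoid.commutativeSemigroup commutativeMonoid)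
    using (interchange)

  Σ : ℕ → (ℕ → A) → A
  Σ zero    f = ε
  Σ (suc n) f = Σ n f ∙ f n

  Σ-cong : ∀ n {f g : ℕ → A} → (∀ i → i < n → f i ≡ g i) → Σ n f ≡ Σ n g
  Σ-cong zero    f≗g = refl
  Σ-cong (suc n) f≗g = cong₂ _∙_ (Σ-cong n (λ i i<n → f≗g i (m<n⇒m<1+n i<n))) (f≗g n (n<1+n n))

  Σ-distrib : ∀ n (f g : ℕ → A) → Σ n (λ i → f i ∙ g i) ≡ Σ n f ∙ Σ n g
  Σ-distrib zero    f g = sym (identityʳ ε)
  Σ-distrib (suc n) f g =
    trans (cong (_∙ (f n ∙ g n)) (Σ-distrib n f g)) (interchange (Σ n f) (Σ n g) (f n) (g n))

  Σ-ε : ∀ n → Σ n (λ _ → ε) ≡ ε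
  Σ-ε zero    = refl
  Σ-ε (suc n) = trans (identityʳ _) (Σ-ε n)

  Σ-swap : ∀ n m (f : ℕ → ℕ → A) → Σ n (λ i → Σ m (f i)) ≡ Σ m (λ j → Σ n (λ i → f i j))
  Σ-swap zero    m f = sym (Σ-ε m)
  Σ-swap (suc n) m f =
    trans (cong (_∙ Σ m (f n)) (Σ-swap n m f)) (sym (Σ-distrib m (λ j → Σ n (λ i → f i j)) (f n)))

  Σ-split : ∀ m n (f : ℕ → A) → Σ (m + n) f ≡ Σ m f ∙ Σ n (λ i → f (m + i))
  Σ-split m zero    f = trans (cong (λ k → Σ k f) (+-identityʳ m)) (sym (identityʳ (Σ m f)))
  Σ-split m (suc n) f = begin
    Σ (m + suc n) f                              ≡⟨ cong (λ k → Σ k f) (+-suc m n) ⟩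
    Σ (m + n) f ∙ f (m + n)                      ≡⟨ cong (_∙ f (m + n)) (Σ-split m n f) ⟩
    (Σ m f ∙ Σ n (λ i → f (m + i))) ∙ f (m + n)  ≡⟨ assoc _ _ _ ⟩
    Σ m f ∙ Σ (suc n) (λ i → f (m + i))          ∎
    where open ≡-Reasoning

  Σ-blocks : ∀ b a (f : ℕ → A) → Σ (b * a) f ≡ Σ b (λ t → Σ a (λ y → f (t * a + y)))
  Σ-blocks zero    a f = refl
  Σ-blocks (suc b) a f = begin
    Σ (a + b * a) f                              ≡⟨ cong (λ k → Σ k f) (+-comm a (b * a)) ⟩
    Σ (b * a + a) f                              ≡⟨ Σ-split (b * a) a f ⟩
    Σ (b * a) f ∙ Σ a (λ y → f (b * a + y))      ≡⟨ cong (_∙ Σ a (λ y → f (b * a + y))) (Σ-blocks b a f) ⟩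
    Σ (suc b) (λ t → Σ a (λ y → f (t * a + y)))  ∎
    where open ≡-Reasoning

module _ {A B : Set} {_∙_ : Op₂ A} {ε : A} {_◦_ : Op₂ B} {ε′ : B}
         (isA : IsCommutativeMonoid _≡_ _∙_ ε) (isB : IsCommutativeMonoid _≡_ _◦_ ε′) where
  private
    module A = FiniteSum isA
    module B = FiniteSum isB

  Σ-homo : (h : A → B) → h ε ≡ ε′ → (∀ x y → h (x ∙ y) ≡ h x ◦ h y) →
           ∀ n f → h (A.Σ n f) ≡ B.Σ n (h ∘ f)
  Σ-homo h h-ε h-∙ zero    f = h-ε
  Σ-homo h h-ε h-∙ (suc n) f = trans (h-∙ (A.Σ n f) (f n)) (cong (_◦ h (f n)) (Σ-homo h h-ε h-∙ n f))

module Counting where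

  open import Data.Nat using (_+_; _*_; _%_)
  open ℕ-Solver using (solve-∀)
  open FiniteSum +-0-isCommutativeMonoid public

  Σ-*ˡ : ∀ n c (f : ℕ → ℕ) → Σ n (λ i → c * f i) ≡ c * Σ n f
  Σ-*ˡ n c f = sym (Σ-homo +-0-isCommutativeMonoid +-0-isCommutativeMonoid (c *_) (*-zeroʳ c) (*-distribˡ-+ c) n f)

  Σ-const : ∀ n c → Σ n (λ _ → c) ≡ n * c
  Σ-const zero    c = refl
  Σ-const (suc n) c = trans (cong (_+ c) (Σ-const n c)) (+-comm (n * c) c)

  Σ≡0⇒≡0 : ∀ n {f : ℕ → ℕ} → Σ n f ≡ 0 → ∀ i → i < n → f i ≡ 0
  Σ≡0⇒≡0 (suc n) Σ≡0 i i<1+n with m<1+n⇒m<n∨m≡n i<1+n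
  ... | inj₁ i<n  = Σ≡0⇒≡0 n (m+n≡0⇒m≡0 _ Σ≡0) i i<n
  ... | inj₂ refl = m+n≡0⇒n≡0 _ Σ≡0

  2*Σid+n≡n*n : ∀ n → 2 * Σ n (λ i → i) + n ≡ n * n
  2*Σid+n≡n*n zero    = refl
  2*Σid+n≡n*n (suc n) = begin
    2 * (Σ n (λ i → i) + n) + suc n        ≡⟨ regroup (Σ n (λ i → i)) n ⟩
    (2 * Σ n (λ i → i) + n) + (2 * n + 1)  ≡⟨ cong (_+ (2 * n + 1)) (2*Σid+n≡n*n n) ⟩
    n * n + (2 * n + 1)                    ≡⟨ square-suc n ⟩
    suc n * suc n                          ∎
    where
      open ≡-Reasoning
      regroup : ∀ s n → 2 * (s + n) + suc n ≡ (2 * s + n) + (2 * n + 1)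
      regroup = solve-∀
      square-suc : ∀ n → n * n + (2 * n + 1) ≡ suc n * suc n
      square-suc = solve-∀

  ⟦_⟧ : ∀ {a} {P : Set a} → Dec P → ℕ
  ⟦ P? ⟧ = if does P? then 1 else 0

  module _ {a} {P : Set a} where

    ⟦⟧-yes : (P? : Dec P) → P → ⟦ P? ⟧ ≡ 1
    ⟦⟧-yes (yes _) _  = refl
    ⟦⟧-yes (no ¬p) p = ⊥-elim (¬p p)

    ⟦⟧-no : (P? : Dec P) → ¬ P → ⟦ P? ⟧ ≡ 0
    ⟦⟧-no (yes p) ¬p = ⊥-elim (¬p p)
    ⟦⟧-no (no _)  _  = refl

    ⟦¬?⟧+⟦⟧≡1 : (P? : Dec P) → ⟦ ¬? P? ⟧ + ⟦ P? ⟧ ≡ 1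
    ⟦¬?⟧+⟦⟧≡1 (yes _) = refl
    ⟦¬?⟧+⟦⟧≡1 (no _)  = refl

    ⟦⟧-*-cong : (P? : Dec P) {x y : ℕ} → (P → x ≡ y) → ⟦ P? ⟧ * x ≡ ⟦ P? ⟧ * y
    ⟦⟧-*-cong (yes p) x≡y = cong (1 *_) (x≡y p)
    ⟦⟧-*-cong (no _)  _   = refl

  ⟦⟧-cong : ∀ {a b} {P : Set a} {Q : Set b} (P? : Dec P) (Q? : Dec Q) → P ⇔ Q → ⟦ P? ⟧ ≡ ⟦ Q? ⟧
  ⟦⟧-cong (yes p) Q? P⇔Q = sym (⟦⟧-yes Q? (Equivalence.to P⇔Q p))
  ⟦⟧-cong (no ¬p) Q? P⇔Q = sym (⟦⟧-no Q? (¬p ∘ Equivalence.from P⇔Q))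

  Σ-select : ∀ n (h : ℕ → ℕ) {b} → b < n → Σ n (λ a → h a * ⟦ b ≟ a ⟧) ≡ h b
  Σ-select (suc n) h {b} b<1+n with m<1+n⇒m<n∨m≡n b<1+n
  ... | inj₁ b<n  = begin
    Σ n (λ a → h a * ⟦ b ≟ a ⟧) + h n * ⟦ b ≟ n ⟧  ≡⟨ cong₂ _+_ (Σ-select n h b<n) (cong (h n *_) (⟦⟧-no (b ≟ n) (λ { refl → <-irrefl refl b<n }))) ⟩
    h b + h n * 0                                  ≡⟨ cong (h b +_) (*-zeroʳ (h n)) ⟩
    h b + 0                                        ≡⟨ +-identityʳ (h b) ⟩
    h b                                            ∎
    where open ≡-Reasoning
  ... | inj₂ refl = begin
    Σ n (λ a → h a * ⟦ n ≟ a ⟧) + h n * ⟦ n ≟ n ⟧  ≡⟨ cong₂ _+_ (Σ-cong n off-diagonal) (cong (h n *_) (⟦⟧-yes (n ≟ n) refl)) ⟩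
    Σ n (λ _ → 0) + h n * 1                        ≡⟨ cong₂ _+_ (Σ-ε n) (*-identityʳ (h n)) ⟩
    h n                                            ∎
    where
      open ≡-Reasoning
      off-diagonal : ∀ a → a < n → h a * ⟦ n ≟ a ⟧ ≡ 0
      off-diagonal a a<n = trans (cong (h a *_) (⟦⟧-no (n ≟ a) (λ { refl → <-irrefl refl a<n }))) (*-zeroʳ (h a))

  fibreSize : ℕ → (ℕ → ℕ) → ℕ → ℕ
  fibreSize n g a = Σ n (λ y → ⟦ g y ≟ a ⟧)

  Σ-fibres : ∀ n m (g w : ℕ → ℕ) → (∀ y → y < n → g y < m) →
             Σ n (w ∘ g) ≡ Σ m (λ a → w a * fibreSize n g a)
  Σ-fibres n m g w g<m = begin
    Σ n (w ∘ g)                                ≡⟨ Σ-cong n (λ y y<n → sym (Σ-select m w (g<m y y<n))) ⟩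
    Σ n (λ y → Σ m (λ a → w a * ⟦ g y ≟ a ⟧))  ≡⟨ Σ-swap n m _ ⟩
    Σ m (λ a → Σ n (λ y → w a * ⟦ g y ≟ a ⟧))  ≡⟨ Σ-cong m (λ a _ → Σ-*ˡ n (w a) _) ⟩
    Σ m (λ a → w a * fibreSize n g a)          ∎
    where open ≡-Reasoning

  count≤1 : ∀ n {P : ℕ → Set} (P? : ∀ i → Dec (P i)) →
            (∀ i j → i < n → j < n → P i → P j → i ≡ j) → Σ n (λ i → ⟦ P? i ⟧) ≤ 1
  count≤1 zero    P? unique = z≤n
  count≤1 (suc n) P? unique with P? n
  ... | yes pn = ≤-reflexive (cong (_+ 1) (trans (Σ-cong n none-below) (Σ-ε n)))
    where
      none-below : ∀ i → i < n → ⟦ P? i ⟧ ≡ 0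
      none-below i i<n = ⟦⟧-no (P? i) (λ pi → <-irrefl (unique i n (m<n⇒m<1+n i<n) (n<1+n n) pi pn) i<n)
  ... | no _   = ≤-trans (≤-reflexive (+-identityʳ _))
                         (count≤1 n P? (λ i j i<n j<n → unique i j (m<n⇒m<1+n i<n) (m<n⇒m<1+n j<n)))

  Σ≡n⇒all≡1 : ∀ n (c : ℕ → ℕ) → (∀ a → a < n → c a ≤ 1) → Σ n c ≡ n → ∀ a → a < n → c a ≡ 1
  Σ≡n⇒all≡1 n c c≤1 Σc≡n a a<n =
    ≤-antisym (c≤1 a a<n) (m∸n≡0⇒m≤n (Σ≡0⇒≡0 n deficit≡0 a a<n))
    where
      deficit≡0 : Σ n (λ a → 1 ∸ c a) ≡ 0
      deficit≡0 = +-cancelʳ-≡ n _ 0 (begin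
        Σ n (λ a → 1 ∸ c a) + n      ≡⟨ cong (Σ n (λ a → 1 ∸ c a) +_) (sym Σc≡n) ⟩
        Σ n (λ a → 1 ∸ c a) + Σ n c  ≡⟨ sym (Σ-distrib n _ c) ⟩
        Σ n (λ a → (1 ∸ c a) + c a)  ≡⟨ Σ-cong n (λ a a<n → m∸n+n≡m (c≤1 a a<n)) ⟩
        Σ n (λ _ → 1)                ≡⟨ trans (Σ-const n 1) (*-identityʳ n) ⟩
        n                                  ∎)
        where open ≡-Reasoning

  Σ-reindex : ∀ n (g w : ℕ → ℕ) → (∀ y → y < n → g y < n) →
              (∀ y y′ → y < n → y′ < n → g y ≡ g y′ → y ≡ y′) → Σ n (w ∘ g) ≡ Σ n w
  Σ-reindex n g w g<n g-injective = begin
    Σ n (w ∘ g)                        ≡⟨ Σ-fibres n n g w g<n ⟩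
    Σ n (λ a → w a * fibreSize n g a)  ≡⟨ Σ-cong n (λ a a<n → trans (cong (w a *_) (fibre≡1 a a<n)) (*-identityʳ (w a))) ⟩
    Σ n w                              ∎
    where
      open ≡-Reasoning
      fibre≤1 : ∀ a → a < n → fibreSize n g a ≤ 1
      fibre≤1 a _ = count≤1 n (λ y → g y ≟ a) (λ y y′ y<n y′<n gy≡a gy′≡a → g-injective y y′ y<n y′<n (trans gy≡a (sym gy′≡a)))
      Σfibres≡n : Σ n (fibreSize n g) ≡ n
      Σfibres≡n = begin
        Σ n (fibreSize n g)              ≡⟨ Σ-cong n (λ a _ → sym (*-identityˡ _)) ⟩
        Σ n (λ a → 1 * fibreSize n g a)  ≡⟨ sym (Σ-fibres n n g (λ _ → 1) g<n) ⟩
        Σ n (λ _ → 1)                    ≡⟨ trans (Σ-const n 1) (*-identityʳ n) ⟩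
        n                                ∎
      fibre≡1 : ∀ a → a < n → fibreSize n g a ≡ 1
      fibre≡1 = Σ≡n⇒all≡1 n (fibreSize n g) fibre≤1 Σfibres≡n

  Σ-periodic : ∀ k R (f : ℕ → ℕ) → (∀ u w → f (u * R + w) ≡ f w) → Σ (k * R) f ≡ k * Σ R f
  Σ-periodic k R f periodic = begin
    Σ (k * R) f                            ≡⟨ Σ-blocks k R f ⟩
    Σ k (λ u → Σ R (λ w → f (u * R + w)))  ≡⟨ Σ-cong k (λ u _ → Σ-cong R (λ w _ → periodic u w)) ⟩
    Σ k (λ _ → Σ R f)                      ≡⟨ Σ-const k (Σ R f) ⟩
    k * Σ R f                              ∎
    where open ≡-Reasoning

  ⟦⊎-dec⟧ : ∀ {a b} {P : Set a} {Q : Set b} (P? : Dec P) (Q? : Dec Q) → ¬ (P × Q) →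
            ⟦ P? ⊎-dec Q? ⟧ ≡ ⟦ P? ⟧ + ⟦ Q? ⟧
  ⟦⊎-dec⟧ (yes p) (yes q) ¬p×q = ⊥-elim (¬p×q (p , q))
  ⟦⊎-dec⟧ (yes _) (no _)  _    = refl
  ⟦⊎-dec⟧ (no _)  (yes _) _    = refl
  ⟦⊎-dec⟧ (no _)  (no _)  _    = refl

  module _ {n : ℕ} {P : ℕ → Set} (P? : ∀ i → Dec (P i)) where

    count-none : (∀ i → i < n → ¬ P i) → Σ n (λ i → ⟦ P? i ⟧) ≡ 0
    count-none none = trans (Σ-cong n (λ i i<n → ⟦⟧-no (P? i) (none i i<n))) (Σ-ε n)

    count-one : ∀ {b} → b < n → (∀ i → i < n → P i ⇔ b ≡ i) → Σ n (λ i → ⟦ P? i ⟧) ≡ 1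
    count-one {b} b<n P⇔b≡ = begin
      Σ n (λ i → ⟦ P? i ⟧)       ≡⟨ Σ-cong n (λ i i<n → trans (⟦⟧-cong (P? i) (b ≟ i) (P⇔b≡ i i<n)) (sym (*-identityˡ _))) ⟩
      Σ n (λ i → 1 * ⟦ b ≟ i ⟧)  ≡⟨ Σ-select n (λ _ → 1) b<n ⟩
      1                          ∎
      where open ≡-Reasoning

    count-two : ∀ {b c} → b < n → c < n → b ≢ c → (∀ i → i < n → P i ⇔ (b ≡ i ⊎ c ≡ i)) →
                Σ n (λ i → ⟦ P? i ⟧) ≡ 2
    count-two {b} {c} b<n c<n b≢c P⇔b≡∨c≡ = begin
      Σ n (λ i → ⟦ P? i ⟧)                                   ≡⟨ Σ-cong n split ⟩
      Σ n (λ i → 1 * ⟦ b ≟ i ⟧ + 1 * ⟦ c ≟ i ⟧)              ≡⟨ Σ-distrib n _ _ ⟩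
      Σ n (λ i → 1 * ⟦ b ≟ i ⟧) + Σ n (λ i → 1 * ⟦ c ≟ i ⟧)  ≡⟨ cong₂ _+_ (Σ-select n (λ _ → 1) b<n) (Σ-select n (λ _ → 1) c<n) ⟩
      2                                                      ∎
      where
        open ≡-Reasoning
        split : ∀ i → i < n → ⟦ P? i ⟧ ≡ 1 * ⟦ b ≟ i ⟧ + 1 * ⟦ c ≟ i ⟧
        split i i<n = begin
          ⟦ P? i ⟧                       ≡⟨ ⟦⟧-cong (P? i) ((b ≟ i) ⊎-dec (c ≟ i)) (P⇔b≡∨c≡ i i<n) ⟩
          ⟦ (b ≟ i) ⊎-dec (c ≟ i) ⟧      ≡⟨ ⟦⊎-dec⟧ (b ≟ i) (c ≟ i) (λ { (refl , refl) → b≢c refl }) ⟩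
          ⟦ b ≟ i ⟧ + ⟦ c ≟ i ⟧          ≡⟨ sym (cong₂ _+_ (*-identityˡ ⟦ b ≟ i ⟧) (*-identityˡ ⟦ c ≟ i ⟧)) ⟩
          1 * ⟦ b ≟ i ⟧ + 1 * ⟦ c ≟ i ⟧  ∎

open Counting

module Residues where

  open import Data.Nat using (_+_; _*_; _%_)
  open ℕ-Solver using (solve-∀)

  [u*R+w]²%R≡w²%R : ∀ u R w .{{_ : NonZero R}} → (u * R + w) * (u * R + w) % R ≡ w * w % R
  [u*R+w]²%R≡w²%R u R w = trans (%-congˡ (expand u R w)) ([m+kn]%n≡m%n (w * w) (u * u * R + 2 * u * w) R)
    where
      expand : ∀ u R w → (u * R + w) * (u * R + w) ≡ w * w + (u * u * R + 2 * u * w) * R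
      expand = solve-∀

  [m+n]%d≡m%d⇒d∣n : ∀ m n d .{{_ : NonZero d}} → (m + n) % d ≡ m % d → d ∣ n
  [m+n]%d≡m%d⇒d∣n m n d [m+n]%d≡m%d = divides q (+-cancelˡ-≡ r n (q * d) (begin
    r + n                ≡⟨ m≡m%n+[m/n]*n (r + n) d ⟩
    (r + n) % d + q * d  ≡⟨ cong (_+ q * d) [r+n]%d≡r ⟩
    r + q * d             ∎))
    where
      open ≡-Reasoning
      r = m % d
      q = (r + n) / d
      [r+n]%d≡r : (r + n) % d ≡ r
      [r+n]%d≡r = begin
        (r + n) % d              ≡⟨ sym ([m+kn]%n≡m%n (r + n) (m / d) d) ⟩
        (r + n + m / d * d) % d  ≡⟨ %-congˡ (swap-last r n (m / d * d)) ⟩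
        (r + m / d * d + n) % d  ≡⟨ %-congˡ (cong (_+ n) (sym (m≡m%n+[m/n]*n m d))) ⟩
        (m + n) % d              ≡⟨ [m+n]%d≡m%d ⟩
        r                        ∎
        where
          swap-last : ∀ a b c → a + b + c ≡ a + c + b
          swap-last = solve-∀

  ∣∧<⇒≡0 : ∀ {d k} → k < d → d ∣ k → k ≡ 0
  ∣∧<⇒≡0 {k = zero}  _   _   = refl
  ∣∧<⇒≡0 {k = suc k} k<d d∣k = ⊥-elim (<⇒≱ k<d (∣⇒≤ d∣k))

  [n∸y]²%n≡y²%n : ∀ n .{{_ : NonZero n}} {y} → y ≤ n → (n ∸ y) * (n ∸ y) % n ≡ y * y % n
  [n∸y]²%n≡y²%n n {y} y≤n = begin
    y′ * y′ % n            ≡⟨ sym ([m+kn]%n≡m%n (y′ * y′) y n) ⟩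
    (y′ * y′ + y * n) % n  ≡⟨ %-congˡ (trans (cong (λ s → y′ * y′ + y * s) (sym y+y′≡n))
                                         (trans (symmetric y y′) (cong (λ s → y * y + y′ * s) y+y′≡n))) ⟩
    (y * y + y′ * n) % n  ≡⟨ [m+kn]%n≡m%n (y * y) y′ n ⟩
    y * y % n             ∎
    where
      open ≡-Reasoning
      y′ = n ∸ y
      y+y′≡n : y + y′ ≡ n
      y+y′≡n = m+[n∸m]≡n y≤n
      symmetric : ∀ y y′ → y′ * y′ + y * (y + y′) ≡ y * y + y′ * (y + y′)
      symmetric = solve-∀

  d∣n∧n<2d⇒n≡0∨n≡d : ∀ {d n} → d ∣ n → n < d + d → n ≡ 0 ⊎ n ≡ d
  d∣n∧n<2d⇒n≡0∨n≡d (divides zero          n≡0)   _    = inj₁ n≡0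
  d∣n∧n<2d⇒n≡0∨n≡d {d} (divides (suc zero) n≡d+0) _  = inj₂ (trans n≡d+0 (+-identityʳ d))
  d∣n∧n<2d⇒n≡0∨n≡d {d} (divides (suc (suc q)) n≡) n<2d =
    ⊥-elim (<⇒≱ n<2d (≤-trans (+-monoʳ-≤ d (m≤m+n d (q * d))) (≤-reflexive (sym n≡))))

open Residues

module ModPrime {p : ℕ} (p-prime : Prime p) where

  open import Data.Nat using (_+_; _*_; _%_)
  open ℕ-Solver using (solve-∀)

  instance
    p≢0 : NonZero p
    p≢0 = prime⇒nonZero p-prime

  1<p : 1 < p
  1<p = nonTrivial⇒n>1 p {{prime⇒nonTrivial p-prime}}

  ∣m*n∧∤m∧n<p⇒n≡0 : ∀ m n → p ∣ m * n → ¬ p ∣ m → n < p → n ≡ 0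
  ∣m*n∧∤m∧n<p⇒n≡0 m n p∣mn p∤m n<p with euclidsLemma m n p-prime p∣mn
  ... | inj₁ p∣m = ⊥-elim (p∤m p∣m)
  ... | inj₂ p∣n = ∣∧<⇒≡0 n<p p∣n

  affine-injective-≤ : ∀ c d {t t′} → ¬ p ∣ d → t ≤ t′ → t′ < p →
                       (c + d * t) % p ≡ (c + d * t′) % p → t ≡ t′
  affine-injective-≤ c d {t} {t′} p∤d t≤t′ t′<p eq =
    trans (sym (+-identityʳ t)) (trans (cong (t +_) (sym k≡0)) (m+[n∸m]≡n t≤t′))
    where
      k = t′ ∸ t
      expand : c + d * t′ ≡ c + d * t + d * k
      expand = trans (cong (λ s → c + d * s) (sym (m+[n∸m]≡n t≤t′))) (distribute c d t k)
        where
          distribute : ∀ c d t k → c + d * (t + k) ≡ c + d * t + d * k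
          distribute = solve-∀
      k≡0 : k ≡ 0
      k≡0 = ∣m*n∧∤m∧n<p⇒n≡0 d k
              ([m+n]%d≡m%d⇒d∣n (c + d * t) (d * k) p (trans (%-congˡ (sym expand)) (sym eq)))
              p∤d (≤-<-trans (m∸n≤m t′ t) t′<p)

  affine-injective : ∀ c d {t t′} → ¬ p ∣ d → t < p → t′ < p →
                     (c + d * t) % p ≡ (c + d * t′) % p → t ≡ t′
  affine-injective c d {t} {t′} p∤d t<p t′<p eq with ≤-total t t′
  ... | inj₁ t≤t′ = affine-injective-≤ c d p∤d t≤t′ t′<p eq
  ... | inj₂ t′≤t = sym (affine-injective-≤ c d p∤d t′≤t t<p (sym eq))

  Σ-affine-% : ∀ c d → ¬ p ∣ d → Σ p (λ t → (c + d * t) % p) ≡ Σ p (λ t → t)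
  Σ-affine-% c d p∤d = Σ-reindex p (λ t → (c + d * t) % p) (λ a → a) (λ t _ → m%n<n _ p)
                         (λ t t′ t<p t′<p → affine-injective c d p∤d t<p t′<p)

  p∣y*y⇒y≡0 : ∀ {y} → y < p → p ∣ y * y → y ≡ 0
  p∣y*y⇒y≡0 {y} y<p p∣y*y with euclidsLemma y y p-prime p∣y*y
  ... | inj₁ p∣y = ∣∧<⇒≡0 y<p p∣y
  ... | inj₂ p∣y = ∣∧<⇒≡0 y<p p∣y

  Σ-multiples : ∀ b (h : ℕ → ℕ) → Σ (b * p) (λ x → ⟦ p ∣? x ⟧ * h x) ≡ Σ b (λ t → h (t * p))
  Σ-multiples b h = trans (Σ-blocks b p _) (Σ-cong b (λ t _ → block t))
    where
      p∣t*p+y⇔0≡y : ∀ t y → y < p → p ∣ t * p + y ⇔ 0 ≡ y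
      p∣t*p+y⇔0≡y t y y<p = mk⇔ (λ p∣ → sym (∣∧<⇒≡0 y<p (∣m+n∣m⇒∣n p∣ (n∣m*n t))))
                                (λ { refl → subst (p ∣_) (sym (+-identityʳ (t * p))) (n∣m*n t) })
      block : ∀ t → Σ p (λ y → ⟦ p ∣? (t * p + y) ⟧ * h (t * p + y)) ≡ h (t * p)
      block t = begin
        Σ p (λ y → ⟦ p ∣? (t * p + y) ⟧ * h (t * p + y))  ≡⟨ Σ-cong p (λ y y<p → trans (cong (_* h (t * p + y)) (⟦⟧-cong (p ∣? (t * p + y)) (0 ≟ y) (p∣t*p+y⇔0≡y t y y<p))) (*-comm ⟦ 0 ≟ y ⟧ (h (t * p + y)))) ⟩
        Σ p (λ y → h (t * p + y) * ⟦ 0 ≟ y ⟧)             ≡⟨ Σ-select p (λ y → h (t * p + y)) (<-trans z<s 1<p) ⟩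
        h (t * p + 0)                                     ≡⟨ cong h (+-identityʳ (t * p)) ⟩
        h (t * p)                                         ∎
        where open ≡-Reasoning

  unit? : ∀ x → Dec (¬ p ∣ x)
  unit? x = ¬? (p ∣? x)

  Σ-units+multiples : ∀ b (h : ℕ → ℕ) →
                      Σ (b * p) h ≡ Σ (b * p) (λ x → ⟦ unit? x ⟧ * h x) + Σ b (λ t → h (t * p))
  Σ-units+multiples b h = begin
    Σ (b * p) h                                             ≡⟨ Σ-cong (b * p) (λ x _ → sym (split x)) ⟩
    Σ (b * p) (λ x → ⟦ unit? x ⟧ * h x + ⟦ p ∣? x ⟧ * h x)  ≡⟨ Σ-distrib (b * p) _ _ ⟩
    units + Σ (b * p) (λ x → ⟦ p ∣? x ⟧ * h x)              ≡⟨ cong (units +_) (Σ-multiples b h) ⟩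
    units + Σ b (λ t → h (t * p))                           ∎
    where
      open ≡-Reasoning
      units = Σ (b * p) (λ x → ⟦ unit? x ⟧ * h x)
      split : ∀ x → ⟦ unit? x ⟧ * h x + ⟦ p ∣? x ⟧ * h x ≡ h x
      split x = begin
        ⟦ unit? x ⟧ * h x + ⟦ p ∣? x ⟧ * h x  ≡⟨ sym (*-distribʳ-+ (h x) ⟦ unit? x ⟧ ⟦ p ∣? x ⟧) ⟩
        (⟦ unit? x ⟧ + ⟦ p ∣? x ⟧) * h x      ≡⟨ cong (_* h x) (⟦¬?⟧+⟦⟧≡1 (p ∣? x)) ⟩
        1 * h x                               ≡⟨ *-identityˡ (h x) ⟩
        h x                                   ∎

  square-roots-≤ : ∀ {y y′} → y ≤ y′ → y′ < p → y′ * y′ % p ≡ y * y % p → y ≡ y′ ⊎ y + y′ ≡ p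
  square-roots-≤ {y} {y′} y≤y′ y′<p eq with euclidsLemma k (y + y′) p-prime p∣k*[y+y′]
    where
      k = y′ ∸ y
      expand : y′ * y′ ≡ y * y + k * (y + y′)
      expand = trans (cong (λ s → s * s) (sym (m+[n∸m]≡n y≤y′)))
                     (trans (difference-of-squares y k) (cong (λ s → y * y + k * (y + s)) (m+[n∸m]≡n y≤y′)))
        where
          difference-of-squares : ∀ y k → (y + k) * (y + k) ≡ y * y + k * (y + (y + k))
          difference-of-squares = solve-∀
      p∣k*[y+y′] : p ∣ k * (y + y′)
      p∣k*[y+y′] = [m+n]%d≡m%d⇒d∣n (y * y) (k * (y + y′)) p (trans (%-congˡ (sym expand)) eq)
  ... | inj₁ p∣k = inj₁ (trans (sym (+-identityʳ y))
                          (trans (cong (y +_) (sym (∣∧<⇒≡0 (≤-<-trans (m∸n≤m y′ y) y′<p) p∣k))) (m+[n∸m]≡n y≤y′)))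
  ... | inj₂ p∣y+y′ with d∣n∧n<2d⇒n≡0∨n≡d p∣y+y′ (+-mono-<-≤ (≤-<-trans y≤y′ y′<p) (<⇒≤ y′<p))
  ...   | inj₂ y+y′≡p = inj₂ y+y′≡p
  ...   | inj₁ y+y′≡0 = inj₁ (trans (m+n≡0⇒m≡0 y y+y′≡0) (sym (m+n≡0⇒n≡0 y y+y′≡0)))

  square-roots : ∀ {y y′} → y < p → y′ < p → y * y % p ≡ y′ * y′ % p → y ≡ y′ ⊎ y + y′ ≡ p
  square-roots {y} {y′} y<p y′<p eq with ≤-total y y′
  ... | inj₁ y≤y′ = square-roots-≤ y≤y′ y′<p (sym eq)
  ... | inj₂ y′≤y with square-roots-≤ y′≤y y<p eq
  ...   | inj₁ y′≡y    = inj₁ (sym y′≡y)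
  ...   | inj₂ y′+y≡p  = inj₂ (trans (+-comm y y′) y′+y≡p)

module QuadraticResidues {p : ℕ} (p-prime : Prime p) (p≢2 : p ≢ 2) where

  open import Data.Nat using (_+_; _*_; _%_)
  open ModPrime p-prime

  square% : ℕ → ℕ
  square% y = y * y % p

  legendre-∣ : ∀ {a} → p ∣ a → legendre a p ≡ ℤ.+ 0
  legendre-∣ {a} p∣a = cong (λ b → if b then ℤ.+ 0 else (if isSquareMod p a then ℤ.+ 1 else ℤ.-[1+ 0 ]))
                            (dec-true (p ∣? a) p∣a)

  legendre-∤ : ∀ {a} → ¬ p ∣ a → legendre a p ≡ (if isSquareMod p a then ℤ.+ 1 else ℤ.-[1+ 0 ])
  legendre-∤ {a} p∤a = cong (λ b → if b then ℤ.+ 0 else (if isSquareMod p a then ℤ.+ 1 else ℤ.-[1+ 0 ]))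
                            (dec-false (p ∣? a) p∤a)

  legendre-residue : ∀ {a y} → ¬ p ∣ a → y < p → square% y ≡ a % p → legendre a p ≡ ℤ.+ 1
  legendre-residue p∤a y<p root =
    trans (legendre-∤ p∤a) (cong (λ b → if b then ℤ.+ 1 else ℤ.-[1+ 0 ]) (dec-true (any? _ (upTo p)) (lose (∈-upTo⁺ y<p) root)))

  legendre-nonresidue : ∀ {a} → ¬ p ∣ a → (∀ y → y < p → square% y ≢ a % p) → legendre a p ≡ ℤ.-[1+ 0 ]
  legendre-nonresidue {a} p∤a no-root =
    trans (legendre-∤ p∤a) (cong (λ b → if b then ℤ.+ 1 else ℤ.-[1+ 0 ]) (dec-false (any? _ (upTo p)) some-root⇒⊥))
    where
      some-root⇒⊥ : ¬ Any (λ y → square% y ≡ a % p) (upTo p)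
      some-root⇒⊥ any with find any
      ... | y , y∈ , root = no-root y (∈-upTo⁻ y∈) root

  fibreSize-square%-residue : ∀ {a y₀} → ¬ p ∣ a → y₀ < p → square% y₀ ≡ a → fibreSize p square% a ≡ 2
  fibreSize-square%-residue {a} {y₀} p∤a y₀<p root =
    count-two (λ y → square% y ≟ a) y₀<p y₁<p y₀≢y₁ roots
    where
      y₁ = p ∸ y₀
      y₀≢0 : y₀ ≢ 0
      y₀≢0 refl = p∤a (subst (p ∣_) (trans (sym (m<n⇒m%n≡m (<-trans z<s 1<p))) root) (divides 0 refl))
      y₁<p : y₁ < p
      y₁<p = ∸-monoʳ-< (n≢0⇒n>0 y₀≢0) (<⇒≤ y₀<p)
      y₀≢y₁ : y₀ ≢ y₁
      y₀≢y₁ y₀≡y₁ with prime⇒irreducible p-prime (divides y₀ (begin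
          p        ≡⟨ sym (m+[n∸m]≡n (<⇒≤ y₀<p)) ⟩
          y₀ + y₁  ≡⟨ cong (y₀ +_) (sym y₀≡y₁) ⟩
          y₀ + y₀  ≡⟨ cong (y₀ +_) (sym (+-identityʳ y₀)) ⟩
          2 * y₀   ≡⟨ *-comm 2 y₀ ⟩
          y₀ * 2   ∎))
        where open ≡-Reasoning
      ... | inj₂ 2≡p = p≢2 (sym 2≡p)
      roots : ∀ y → y < p → square% y ≡ a ⇔ (y₀ ≡ y ⊎ y₁ ≡ y)
      roots y y<p = mk⇔ to from
        where
          to : square% y ≡ a → y₀ ≡ y ⊎ y₁ ≡ y
          to y²≡a with square-roots y<p y₀<p (trans y²≡a (sym root))
          ... | inj₁ y≡y₀    = inj₁ (sym y≡y₀)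
          ... | inj₂ y+y₀≡p  = inj₂ (trans (cong (_∸ y₀) (sym y+y₀≡p)) (m+n∸n≡m y y₀))
          from : y₀ ≡ y ⊎ y₁ ≡ y → square% y ≡ a
          from (inj₁ refl) = root
          from (inj₂ refl) = trans ([n∸y]²%n≡y²%n p (<⇒≤ y₀<p)) root

  fibreSize-square%≡1+legendre : ∀ {a} → a < p → ℤ.+ fibreSize p square% a ≡ (ℤ.+ 1) ℤ.+ legendre a p
  -- The case split lives in a helper: `with p ∣? a` would also rewrite the copy inside `legendre a p`.
  fibreSize-square%≡1+legendre {a} a<p = by-cases (p ∣? a) (any? (λ y → square% y ≟ a % p) (upTo p))
    where
      fibre = ℤ.+ fibreSize p square% a
      a%p≡a = m<n⇒m%n≡m a<p
      by-cases : Dec (p ∣ a) → Dec (Any (λ y → square% y ≡ a % p) (upTo p)) → fibre ≡ (ℤ.+ 1) ℤ.+ legendre a p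
      by-cases (yes p∣a) _ = trans (cong ℤ.+_ (count-one (λ y → square% y ≟ a) 0<p only-zero))
                                   (sym (cong (ℤ._+_ (ℤ.+ 1)) (legendre-∣ p∣a)))
        where
          0<p = <-trans z<s 1<p
          a≡0 = ∣∧<⇒≡0 a<p p∣a
          only-zero : ∀ y → y < p → square% y ≡ a ⇔ 0 ≡ y
          only-zero y y<p = mk⇔
            (λ y²≡a → sym (p∣y*y⇒y≡0 y<p (m%n≡0⇒n∣m (y * y) p (trans y²≡a a≡0))))
            (λ { refl → trans (m<n⇒m%n≡m 0<p) (sym a≡0) })
      by-cases (no p∤a) (yes some-root) with find some-root
      ... | y₀ , y₀∈ , root =
        trans (cong ℤ.+_ (fibreSize-square%-residue p∤a (∈-upTo⁻ y₀∈) (trans root a%p≡a)))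
              (sym (cong (ℤ._+_ (ℤ.+ 1)) (legendre-residue p∤a (∈-upTo⁻ y₀∈) root)))
      by-cases (no p∤a) (no no-root) =
        trans (cong ℤ.+_ (count-none (λ y → square% y ≟ a) (λ y y<p root → no-root′ y y<p (trans root (sym a%p≡a)))))
              (sym (cong (ℤ._+_ (ℤ.+ 1)) (legendre-nonresidue p∤a no-root′)))
        where
          no-root′ : ∀ y → y < p → square% y ≢ a % p
          no-root′ y y<p root = no-root (lose (∈-upTo⁺ y<p) root)

module PrimePowerSquareSums {p : ℕ} (p-prime : Prime p) (p≢2 : p ≢ 2) where

  open import Data.Nat using (_+_; _*_; _%_)
  open ℕ-Solver using (solve-∀)
  open ModPrime p-prime

  square%p^ : ℕ → ℕ → ℕ
  square%p^ r x = _%_ (x * x) (p ^ r) {{m^n≢0 p r}}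

  squareSum unitSquareSum unitCount : ℕ → ℕ
  squareSum     r = Σ (p ^ r) (square%p^ r)
  unitSquareSum r = Σ (p ^ r) (λ x → ⟦ unit? x ⟧ * square%p^ r x)
  unitCount     r = Σ (p ^ r) (λ x → ⟦ unit? x ⟧)

  Σ-square%p^-periodic : ∀ r → Σ (p ^ suc r) (square%p^ r) ≡ p * squareSum r
  Σ-square%p^-periodic r = Σ-periodic p (p ^ r) (square%p^ r) (λ u w → [u*R+w]²%R≡w²%R u (p ^ r) w {{m^n≢0 p r}})

  square%p^-multiple : ∀ r t → square%p^ (2 + r) (t * p) ≡ p * p * square%p^ r t
  square%p^-multiple r t = begin
    t * p * (t * p) % (p * (p * p ^ r))  ≡⟨ %-congˡ (regroup t p) ⟩
    t * t * (p * p) % (p * (p * p ^ r))  ≡⟨ %-congʳ (rotate p (p ^ r)) ⟩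
    t * t * (p * p) % (p ^ r * (p * p))  ≡⟨ sym (m%n*o≡m*o%[n*o] (t * t) (p ^ r) (p * p)) ⟩
    t * t % p ^ r * (p * p)              ≡⟨ *-comm (t * t % p ^ r) (p * p) ⟩
    p * p * (t * t % p ^ r)              ∎
    where
      open ≡-Reasoning
      instance
        _ = m^n≢0 p r
        _ = m^n≢0 p (2 + r)
        _ = m*n≢0 p p
        _ = m*n≢0 (p ^ r) (p * p)
      regroup : ∀ t p → t * p * (t * p) ≡ t * t * (p * p)
      regroup = solve-∀
      rotate : ∀ p R → p * (p * R) ≡ R * (p * p)
      rotate = solve-∀

  squareSum-rec : ∀ r → squareSum (2 + r) ≡ unitSquareSum (2 + r) + p * p * p * squareSum r
  squareSum-rec r = begin
    Σ N (square%p^ (2 + r))                ≡⟨ cong (λ n → Σ n (square%p^ (2 + r))) N≡ ⟩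
    Σ (p ^ suc r * p) (square%p^ (2 + r))  ≡⟨ Σ-units+multiples (p ^ suc r) (square%p^ (2 + r)) ⟩
    units (p ^ suc r * p) + Σ (p ^ suc r) (λ t → square%p^ (2 + r) (t * p))
                                                                    ≡⟨ cong₂ _+_ (cong units (sym N≡)) (Σ-cong (p ^ suc r) (λ t _ → square%p^-multiple r t)) ⟩
    units N + Σ (p ^ suc r) (λ t → p * p * square%p^ r t)  ≡⟨ cong (units N +_) (Σ-*ˡ (p ^ suc r) (p * p) (square%p^ r)) ⟩
    units N + p * p * Σ (p ^ suc r) (square%p^ r)          ≡⟨ cong (λ s → units N + p * p * s) (Σ-square%p^-periodic r) ⟩
    units N + p * p * (p * squareSum r)                    ≡⟨ cong (units N +_) (sym (*-assoc (p * p) p (squareSum r))) ⟩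
    unitSquareSum (2 + r) + p * p * p * squareSum r        ∎
    where
      open ≡-Reasoning
      N = p ^ (2 + r)
      N≡ = *-comm p (p ^ suc r)
      units : ℕ → ℕ
      units n = Σ n (λ x → ⟦ unit? x ⟧ * square%p^ (2 + r) x)

  unitCount+p^s≡p^[1+s] : ∀ s → unitCount (suc s) + p ^ s ≡ p ^ suc s
  unitCount+p^s≡p^[1+s] s = begin
    unitCount (suc s) + p ^ s                ≡⟨ cong₂ _+_ (Σ-cong (p ^ suc s) (λ x _ → sym (*-identityʳ ⟦ unit? x ⟧))) (sym (trans (Σ-const (p ^ s) 1) (*-identityʳ (p ^ s)))) ⟩
    units (p ^ suc s) + Σ (p ^ s) (λ _ → 1)  ≡⟨ cong (λ n → units n + Σ (p ^ s) (λ _ → 1)) N≡ ⟩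
    units (p ^ s * p) + Σ (p ^ s) (λ _ → 1)  ≡⟨ sym (Σ-units+multiples (p ^ s) (λ _ → 1)) ⟩
    Σ (p ^ s * p) (λ _ → 1)                  ≡⟨ trans (Σ-const (p ^ s * p) 1) (*-identityʳ (p ^ s * p)) ⟩
    p ^ s * p                                ≡⟨ sym N≡ ⟩
    p ^ suc s                                ∎
    where
      open ≡-Reasoning
      N≡ = *-comm p (p ^ s)
      units : ℕ → ℕ
      units n = Σ n (λ x → ⟦ unit? x ⟧ * 1)

  unitSquareSum-1 : unitSquareSum 1 ≡ squareSum 1
  unitSquareSum-1 = begin
    units (p ^ 1)                                    ≡⟨ sym (+-identityʳ (units (p ^ 1))) ⟩
    units (p ^ 1) + 0                                ≡⟨ cong₂ _+_ (cong units (*-comm p 1)) (sym square-of-0) ⟩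
    units (1 * p) + Σ 1 (λ t → square%p^ 1 (t * p))  ≡⟨ sym (Σ-units+multiples 1 (square%p^ 1)) ⟩
    Σ (1 * p) (square%p^ 1)                          ≡⟨ cong (λ n → Σ n (square%p^ 1)) (*-comm 1 p) ⟩
    squareSum 1                                      ∎
    where
      open ≡-Reasoning
      units : ℕ → ℕ
      units n = Σ n (λ x → ⟦ unit? x ⟧ * square%p^ 1 x)
      square-of-0 : Σ 1 (λ t → square%p^ 1 (t * p)) ≡ 0
      square-of-0 = m<n⇒m%n≡m {{m^n≢0 p 1}} (subst (0 <_) (sym (*-identityʳ p)) (<-trans z<s 1<p))

  p∤y⇒p∤2*y : ∀ {y} → ¬ p ∣ y → ¬ p ∣ 2 * y
  p∤y⇒p∤2*y {y} p∤y p∣2y with euclidsLemma 2 y p-prime p∣2y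
  ... | inj₁ p∣2 = p≢2 (≤-antisym (∣⇒≤ p∣2) 1<p)
  ... | inj₂ p∣y = p∤y p∣y

  square%p^-lift : ∀ s y t → square%p^ (2 + s) (t * p ^ suc s + y) ≡
                   square%p^ (suc s) y + p ^ suc s * ((_/_ (y * y) (p ^ suc s) {{m^n≢0 p (suc s)}} + 2 * y * t) % p)
  square%p^-lift s y t = begin
    (t * R + y) * (t * R + y) % (p * R)  ≡⟨ %-congˡ expand ⟩
    (M * R + A) % (p * R)                ≡⟨ [m*n+o]%[p*n]≡[m*n]%[p*n]+o M p (m%n<n (y * y) R) ⟩
    M * R % (p * R) + A                  ≡⟨ cong (_+ A) (sym (m%n*o≡m*o%[n*o] M p R)) ⟩
    M % p * R + A                        ≡⟨ cong (λ m → m * R + A) ([m+kn]%n≡m%n (Q + 2 * y * t) (t * t * p ^ s) p) ⟩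
    (Q + 2 * y * t) % p * R + A          ≡⟨ +-comm _ A ⟩
    A + (Q + 2 * y * t) % p * R          ≡⟨ cong (A +_) (*-comm ((Q + 2 * y * t) % p) R) ⟩
    A + R * ((Q + 2 * y * t) % p)        ∎
    where
      open ≡-Reasoning
      R = p ^ suc s
      instance
        _ = m^n≢0 p (suc s)
        _ = m^n≢0 p (2 + s)
      A = y * y % R
      Q = y * y / R
      M = Q + 2 * y * t + t * t * p ^ s * p
      binomial : ∀ t p P y → (t * (p * P) + y) * (t * (p * P) + y) ≡ y * y + (2 * y * t + t * t * P * p) * (p * P)
      binomial = solve-∀
      collect : ∀ A Q R X Y → A + Q * R + (X + Y) * R ≡ (Q + X + Y) * R + A
      collect = solve-∀
      expand : (t * R + y) * (t * R + y) ≡ M * R + A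
      expand = begin
        (t * R + y) * (t * R + y)                        ≡⟨ binomial t p (p ^ s) y ⟩
        y * y + (2 * y * t + t * t * p ^ s * p) * R      ≡⟨ cong (_+ (2 * y * t + t * t * p ^ s * p) * R) (m≡m%n+[m/n]*n (y * y) R) ⟩
        A + Q * R + (2 * y * t + t * t * p ^ s * p) * R  ≡⟨ collect A Q R (2 * y * t) (t * t * p ^ s * p) ⟩
        M * R + A                                        ∎

  Σ-square%p^-lift : ∀ s y → ¬ p ∣ y →
    Σ p (λ t → square%p^ (2 + s) (t * p ^ suc s + y)) ≡ p * square%p^ (suc s) y + p ^ suc s * Σ p (λ t → t)
  Σ-square%p^-lift s y p∤y = begin
    Σ p (λ t → square%p^ (2 + s) (t * R + y))              ≡⟨ Σ-cong p (λ t _ → square%p^-lift s y t) ⟩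
    Σ p (λ t → A + R * ((Q + 2 * y * t) % p))              ≡⟨ Σ-distrib p (λ _ → A) _ ⟩
    Σ p (λ _ → A) + Σ p (λ t → R * ((Q + 2 * y * t) % p))  ≡⟨ cong₂ _+_ (Σ-const p A) (Σ-*ˡ p R _) ⟩
    p * A + R * Σ p (λ t → (Q + 2 * y * t) % p)            ≡⟨ cong (λ s → p * A + R * s) (Σ-affine-% Q (2 * y) (p∤y⇒p∤2*y p∤y)) ⟩
    p * A + R * Σ p (λ t → t)                              ∎
    where
      open ≡-Reasoning
      R = p ^ suc s
      A = square%p^ (suc s) y
      Q = _/_ (y * y) R {{m^n≢0 p (suc s)}}

  unit?-shift : ∀ s t y → ⟦ unit? (t * p ^ suc s + y) ⟧ ≡ ⟦ unit? y ⟧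
  unit?-shift s t y = ⟦⟧-cong (unit? (t * p ^ suc s + y)) (unit? y)
    (mk⇔ (λ p∤ p∣y → p∤ (∣m∣n⇒∣m+n p∣t*p^[1+s] p∣y)) (λ p∤y p∣ → p∤y (∣m+n∣m⇒∣n p∣ p∣t*p^[1+s])))
    where
      p∣t*p^[1+s] : p ∣ t * p ^ suc s
      p∣t*p^[1+s] = ∣n⇒∣m*n t (m∣m*n (p ^ s))

  unitSquareSum-rec : ∀ s → unitSquareSum (2 + s) ≡
                      p * unitSquareSum (suc s) + p ^ suc s * Σ p (λ t → t) * unitCount (suc s)
  unitSquareSum-rec s = begin
    Σ (p * R) (λ x → ⟦ unit? x ⟧ * sq₂ x)                                ≡⟨ Σ-blocks p R _ ⟩
    Σ p (λ t → Σ R (λ y → ⟦ unit? (t * R + y) ⟧ * sq₂ (t * R + y)))      ≡⟨ Σ-swap p R _ ⟩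
    Σ R (λ y → Σ p (λ t → ⟦ unit? (t * R + y) ⟧ * sq₂ (t * R + y)))      ≡⟨ Σ-cong R (λ y _ → factor y) ⟩
    Σ R (λ y → ⟦ unit? y ⟧ * Σ p (λ t → sq₂ (t * R + y)))                ≡⟨ Σ-cong R (λ y _ → ⟦⟧-*-cong (unit? y) (Σ-square%p^-lift s y)) ⟩
    Σ R (λ y → ⟦ unit? y ⟧ * (p * sq₁ y + K))                            ≡⟨ Σ-cong R (λ y _ → distribute ⟦ unit? y ⟧ p (sq₁ y) K) ⟩
    Σ R (λ y → p * (⟦ unit? y ⟧ * sq₁ y) + K * ⟦ unit? y ⟧)              ≡⟨ Σ-distrib R _ _ ⟩
    Σ R (λ y → p * (⟦ unit? y ⟧ * sq₁ y)) + Σ R (λ y → K * ⟦ unit? y ⟧)  ≡⟨ cong₂ _+_ (Σ-*ˡ R p _) (Σ-*ˡ R K _) ⟩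
    p * unitSquareSum (suc s) + K * unitCount (suc s)                    ∎
    where
      open ≡-Reasoning
      R = p ^ suc s
      K = R * Σ p (λ t → t)
      sq₁ = square%p^ (suc s)
      sq₂ = square%p^ (2 + s)
      factor : ∀ y → Σ p (λ t → ⟦ unit? (t * R + y) ⟧ * sq₂ (t * R + y)) ≡ ⟦ unit? y ⟧ * Σ p (λ t → sq₂ (t * R + y))
      factor y = trans (Σ-cong p (λ t _ → cong (_* sq₂ (t * R + y)) (unit?-shift s t y))) (Σ-*ˡ p ⟦ unit? y ⟧ _)
      distribute : ∀ i p g K → i * (p * g + K) ≡ p * (i * g) + K * i
      distribute = solve-∀

module ℤΣ = FiniteSum ℤP.+-0-isCommutativeMonoid
module ℚΣ = FiniteSum ℚP.+-0-isCommutativeMonoid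

pos-Σ : ∀ n f → ℤ.+ Σ n f ≡ ℤΣ.Σ n (λ i → ℤ.+ f i)
pos-Σ = Σ-homo ℕP.+-0-isCommutativeMonoid ℤP.+-0-isCommutativeMonoid ℤ.+_ refl ℤP.pos-+

module ClosedForm {p : ℕ} (p-prime : Prime p) (p≢2 : p ≢ 2) where

  open ℤ using (ℤ; +_; _+_; _*_; _-_)
  open ℤ-Solver using (solve-∀)
  open ModPrime p-prime using (p≢0)
  open QuadraticResidues p-prime p≢2 using (square%; fibreSize-square%≡1+legendre)
  open PrimePowerSquareSums p-prime p≢2

  legendreMoment : ℤ
  legendreMoment = ℤΣ.Σ p (λ a → legendre a p * + a)

  P : ℤ
  P = + p

  squareSum-1 : + squareSum 1 ≡ + Σ p (λ a → a) + legendreMoment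
  squareSum-1 = begin
    + squareSum 1                                   ≡⟨ cong +_ mod-p ⟩
    + Σ p (λ y → square% y)                         ≡⟨ cong +_ (Σ-fibres p p square% (λ a → a) (λ y _ → m%n<n (y ℕ.* y) p)) ⟩
    + Σ p (λ a → a ℕ.* fibreSize p square% a)       ≡⟨ pos-Σ p _ ⟩
    ℤΣ.Σ p (λ a → + (a ℕ.* fibreSize p square% a))  ≡⟨ ℤΣ.Σ-cong p (λ a a<p → weight a a<p) ⟩
    ℤΣ.Σ p (λ a → + a + legendre a p * + a)         ≡⟨ ℤΣ.Σ-distrib p _ _ ⟩
    ℤΣ.Σ p (λ a → + a) + legendreMoment             ≡⟨ cong (_+ legendreMoment) (sym (pos-Σ p (λ a → a))) ⟩
    + Σ p (λ a → a) + legendreMoment                ∎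
    where
      open ≡-Reasoning
      mod-p : squareSum 1 ≡ Σ p square%
      mod-p = trans (cong (λ n → Σ n (square%p^ 1)) (ℕP.*-identityʳ p))
                    (Σ-cong p (λ y _ → %-congʳ {{ℕP.m^n≢0 p 1}} (ℕP.*-identityʳ p)))
      weight : ∀ a → a ℕ.< p → + (a ℕ.* fibreSize p square% a) ≡ + a + legendre a p * + a
      weight a a<p = begin
        + (a ℕ.* fibreSize p square% a)  ≡⟨ ℤP.pos-* a _ ⟩
        + a * + fibreSize p square% a    ≡⟨ cong (+ a *_) (fibreSize-square%≡1+legendre a<p) ⟩
        + a * (+ 1 + legendre a p)       ≡⟨ expand (+ a) (legendre a p) ⟩
        + a + legendre a p * + a         ∎
        where
          expand : ∀ a l → a * (+ 1 + l) ≡ a + l * a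
          expand = solve-∀

  P^ : ℕ → ℤ
  P^ k = + (p ^ k)

  P^-suc : ∀ k → P^ (suc k) ≡ P * P^ k
  P^-suc k = ℤP.pos-* p (p ^ k)

  2*Σid≡P*P-P : + 2 * + Σ p (λ a → a) ≡ P * P - P
  2*Σid≡P*P-P = begin
    + 2 * S            ≡⟨ add-sub (+ 2 * S) P ⟩
    (+ 2 * S + P) - P  ≡⟨ cong (_- P) cast ⟩
    P * P - P          ∎
    where
      open ≡-Reasoning
      S = + Σ p (λ a → a)
      add-sub : ∀ a b → a ≡ (a + b) - b
      add-sub = solve-∀
      cast : + 2 * S + P ≡ P * P
      cast = begin
        + 2 * S + P                    ≡⟨ cong (_+ P) (sym (ℤP.pos-* 2 (Σ p (λ a → a)))) ⟩
        + (2 ℕ.* Σ p (λ a → a)) + P    ≡⟨ sym (ℤP.pos-+ _ p) ⟩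
        + (2 ℕ.* Σ p (λ a → a) ℕ.+ p)  ≡⟨ cong +_ (2*Σid+n≡n*n p) ⟩
        + (p ℕ.* p)                    ≡⟨ ℤP.pos-* p p ⟩
        P * P                          ∎

  unitCount≡P*P^s-P^s : ∀ s → + unitCount (suc s) ≡ P * P^ s - P^ s
  unitCount≡P*P^s-P^s s = begin
    + unitCount (suc s)                     ≡⟨ add-sub (+ unitCount (suc s)) (P^ s) ⟩
    (+ unitCount (suc s) + P^ s) - P^ s     ≡⟨ cong (_- P^ s) (sym (ℤP.pos-+ (unitCount (suc s)) (p ^ s))) ⟩
    + (unitCount (suc s) ℕ.+ p ^ s) - P^ s  ≡⟨ cong (λ n → + n - P^ s) (unitCount+p^s≡p^[1+s] s) ⟩
    P^ (suc s) - P^ s                       ≡⟨ cong (_- P^ s) (P^-suc s) ⟩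
    P * P^ s - P^ s                         ∎
    where
      open ≡-Reasoning
      add-sub : ∀ a b → a ≡ (a + b) - b
      add-sub = solve-∀

  +unitSquareSum-rec : ∀ s → + unitSquareSum (2 ℕ.+ s) ≡
                       P * + unitSquareSum (suc s) + P * P^ s * + Σ p (λ a → a) * + unitCount (suc s)
  +unitSquareSum-rec s = begin
    + unitSquareSum (2 ℕ.+ s)                ≡⟨ cong +_ (unitSquareSum-rec s) ⟩
    + (p ℕ.* U ℕ.+ p ^ suc s ℕ.* S ℕ.* c)    ≡⟨ ℤP.pos-+ (p ℕ.* U) _ ⟩
    + (p ℕ.* U) + + (p ^ suc s ℕ.* S ℕ.* c)  ≡⟨ cong₂ _+_ (ℤP.pos-* p U) (trans (ℤP.pos-* (p ^ suc s ℕ.* S) c) (cong (_* + c) (ℤP.pos-* (p ^ suc s) S))) ⟩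
    P * + U + P^ (suc s) * + S * + c         ≡⟨ cong (λ x → P * + U + x * + S * + c) (P^-suc s) ⟩
    P * + U + P * P^ s * + S * + c           ∎
    where
      open ≡-Reasoning
      U = unitSquareSum (suc s)
      S = Σ p (λ a → a)
      c = unitCount (suc s)

  +squareSum-rec : ∀ r → + squareSum (2 ℕ.+ r) ≡ + unitSquareSum (2 ℕ.+ r) + P * P * P * + squareSum r
  +squareSum-rec r = begin
    + squareSum (2 ℕ.+ r)          ≡⟨ cong +_ (squareSum-rec r) ⟩
    + (U ℕ.+ p ℕ.* p ℕ.* p ℕ.* T)  ≡⟨ ℤP.pos-+ U _ ⟩
    + U + + (p ℕ.* p ℕ.* p ℕ.* T)  ≡⟨ cong (_+_ (+ U)) (trans (ℤP.pos-* (p ℕ.* p ℕ.* p) T) (cong (_* + T) (trans (ℤP.pos-* (p ℕ.* p) p) (cong (_* P) (ℤP.pos-* p p))))) ⟩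
    + U + P * P * P * + T          ∎
    where
      open ≡-Reasoning
      U = unitSquareSum (2 ℕ.+ r)
      T = squareSum r

  2*unitSquareSum : ∀ s → + 2 * + unitSquareSum (suc s) ≡ (P - + 1) * P * (P^ s * P^ s) + + 2 * P^ s * legendreMoment
  2*unitSquareSum zero = begin
    + 2 * + unitSquareSum 1                                   ≡⟨ cong (λ u → + 2 * + u) unitSquareSum-1 ⟩
    + 2 * + squareSum 1                                       ≡⟨ cong (+ 2 *_) squareSum-1 ⟩
    + 2 * (+ Σ p (λ a → a) + legendreMoment)                  ≡⟨ distrib (+ Σ p (λ a → a)) legendreMoment ⟩
    + 2 * + Σ p (λ a → a) + + 2 * legendreMoment              ≡⟨ cong (_+ + 2 * legendreMoment) 2*Σid≡P*P-P ⟩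
    P * P - P + + 2 * legendreMoment                          ≡⟨ rearrange P legendreMoment ⟩
    (P - + 1) * P * (+ 1 * + 1) + + 2 * + 1 * legendreMoment  ∎
    where
      open ≡-Reasoning
      distrib : ∀ s l → + 2 * (s + l) ≡ + 2 * s + + 2 * l
      distrib = solve-∀
      rearrange : ∀ P l → P * P - P + + 2 * l ≡ (P - + 1) * P * (+ 1 * + 1) + + 2 * + 1 * l
      rearrange = solve-∀
  2*unitSquareSum (suc s) = begin
    + 2 * + unitSquareSum (2 ℕ.+ s)        ≡⟨ cong (+ 2 *_) (+unitSquareSum-rec s) ⟩
    + 2 * (P * U + P * X * S * c)          ≡⟨ regroup P X U S c ⟩
    P * (+ 2 * U) + P * X * (+ 2 * S) * c  ≡⟨ cong₂ (λ u c → P * u + P * X * (+ 2 * S) * c) (2*unitSquareSum s) (unitCount≡P*P^s-P^s s) ⟩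
    P * ((P - + 1) * P * (X * X) + + 2 * X * L) + P * X * (+ 2 * S) * (P * X - X)
                                                                        ≡⟨ cong (λ t → P * ((P - + 1) * P * (X * X) + + 2 * X * L) + P * X * t * (P * X - X)) 2*Σid≡P*P-P ⟩
    P * ((P - + 1) * P * (X * X) + + 2 * X * L) + P * X * (P * P - P) * (P * X - X)
                                                                        ≡⟨ collect P X L ⟩
    (P - + 1) * P * ((P * X) * (P * X)) + + 2 * (P * X) * L           ≡⟨ cong (λ Y → (P - + 1) * P * (Y * Y) + + 2 * Y * L) (sym (P^-suc s)) ⟩
    (P - + 1) * P * (P^ (suc s) * P^ (suc s)) + + 2 * P^ (suc s) * L  ∎
    where
      open ≡-Reasoning
      X = P^ s
      L = legendreMoment
      U = + unitSquareSum (suc s)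
      S = + Σ p (λ a → a)
      c = + unitCount (suc s)
      regroup : ∀ P X U S c → + 2 * (P * U + P * X * S * c) ≡ P * (+ 2 * U) + P * X * (+ 2 * S) * c
      regroup = solve-∀
      collect : ∀ P X L → P * ((P - + 1) * P * (X * X) + + 2 * X * L) + P * X * (P * P - P) * (P * X - X)
                          ≡ (P - + 1) * P * ((P * X) * (P * X)) + + 2 * (P * X) * L
      collect = solve-∀

  formula : ℤ → ℤ → ℤ → ℤ
  formula N F C = P * (P - + 1) * N * (N - F) + + 2 * N * (C - + 1) * legendreMoment

  closedForm : ℕ → ℤ
  closedForm r = formula (P^ r) (P^ (r / 2)) (P^ ((r ℕ.+ 1) / 2))

  [2+m]/2≡1+m/2 : ∀ m → (2 ℕ.+ m) / 2 ≡ suc (m / 2)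
  [2+m]/2≡1+m/2 m = m/n≡1+[m∸n]/n {2 ℕ.+ m} {2} (ℕ.s≤s (ℕ.s≤s ℕ.z≤n))

  closedForm-rec : ∀ r → closedForm (2 ℕ.+ r) ≡
    P * (P - + 1) * ((P - + 1) * P * ((P * P^ r) * (P * P^ r)) + + 2 * (P * P^ r) * legendreMoment)
    + P * P * P * closedForm r
  closedForm-rec r = begin
    closedForm (2 ℕ.+ r)                   ≡⟨ cong₂ (λ N′ F′ → formula N′ F′ C′) N′≡ F′≡ ⟩
    formula (P * (P * N)) (P * F) C′       ≡⟨ cong (formula (P * (P * N)) (P * F)) C′≡ ⟩
    formula (P * (P * N)) (P * F) (P * C)  ≡⟨ expand P N F C legendreMoment ⟩
    P * (P - + 1) * ((P - + 1) * P * ((P * N) * (P * N)) + + 2 * (P * N) * legendreMoment)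
      + P * P * P * closedForm r                           ∎
    where
      open ≡-Reasoning
      N = P^ r
      F = P^ (r / 2)
      C = P^ ((r ℕ.+ 1) / 2)
      C′ = P^ ((2 ℕ.+ r ℕ.+ 1) / 2)
      N′≡ : P^ (2 ℕ.+ r) ≡ P * (P * N)
      N′≡ = trans (P^-suc (suc r)) (cong (P *_) (P^-suc r))
      F′≡ : P^ ((2 ℕ.+ r) / 2) ≡ P * F
      F′≡ = trans (cong P^ ([2+m]/2≡1+m/2 r)) (P^-suc (r / 2))
      C′≡ : C′ ≡ P * C
      C′≡ = trans (cong P^ ([2+m]/2≡1+m/2 (r ℕ.+ 1))) (P^-suc ((r ℕ.+ 1) / 2))
      expand : ∀ P N F C L →
        P * (P - + 1) * (P * (P * N)) * (P * (P * N) - P * F) + + 2 * (P * (P * N)) * (P * C - + 1) * L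
        ≡ P * (P - + 1) * ((P - + 1) * P * ((P * N) * (P * N)) + + 2 * (P * N) * L)
          + P * P * P * (P * (P - + 1) * N * (N - F) + + 2 * N * (C - + 1) * L)
      expand = solve-∀

  2*p*[p-1]*squareSum : ∀ r → + 2 * P * (P - + 1) * + squareSum r ≡ closedForm r
  2*p*[p-1]*squareSum zero = vanish P legendreMoment
    where
      vanish : ∀ P L → + 2 * P * (P - + 1) * + 0 ≡ P * (P - + 1) * + 1 * (+ 1 - + 1) + + 2 * + 1 * (+ 1 - + 1) * L
      vanish = solve-∀
  2*p*[p-1]*squareSum (suc zero) = begin
    + 2 * P * (P - + 1) * + squareSum 1                                         ≡⟨ cong (λ t → + 2 * P * (P - + 1) * + t) (sym unitSquareSum-1) ⟩
    + 2 * P * (P - + 1) * + unitSquareSum 1                                     ≡⟨ regroup P (+ unitSquareSum 1) ⟩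
    P * (P - + 1) * (+ 2 * + unitSquareSum 1)                                   ≡⟨ cong (P * (P - + 1) *_) (2*unitSquareSum 0) ⟩
    P * (P - + 1) * ((P - + 1) * P * (+ 1 * + 1) + + 2 * + 1 * legendreMoment)  ≡⟨ base P legendreMoment ⟩
    P * (P - + 1) * P * (P - + 1) + + 2 * P * (P - + 1) * legendreMoment        ≡⟨ cong (λ N → P * (P - + 1) * N * (N - + 1) + + 2 * N * (N - + 1) * legendreMoment) (sym P^1≡P) ⟩
    closedForm 1                                                                ∎
    where
      open ≡-Reasoning
      P^1≡P : P^ 1 ≡ P
      P^1≡P = cong +_ (ℕP.*-identityʳ p)
      regroup : ∀ P u → + 2 * P * (P - + 1) * u ≡ P * (P - + 1) * (+ 2 * u)
      regroup = solve-∀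
      base : ∀ P L → P * (P - + 1) * ((P - + 1) * P * (+ 1 * + 1) + + 2 * + 1 * L)
                     ≡ P * (P - + 1) * P * (P - + 1) + + 2 * P * (P - + 1) * L
      base = solve-∀
  2*p*[p-1]*squareSum (suc (suc r)) = begin
    + 2 * P * (P - + 1) * + squareSum (2 ℕ.+ r)                        ≡⟨ cong (+ 2 * P * (P - + 1) *_) (+squareSum-rec r) ⟩
    + 2 * P * (P - + 1) * (U + P * P * P * T)                          ≡⟨ regroup P U T ⟩
    P * (P - + 1) * (+ 2 * U) + P * P * P * (+ 2 * P * (P - + 1) * T)  ≡⟨ cong₂ (λ u t → P * (P - + 1) * u + P * P * P * t) (2*unitSquareSum (suc r)) (2*p*[p-1]*squareSum r) ⟩
    P * (P - + 1) * ((P - + 1) * P * (P^ (suc r) * P^ (suc r)) + + 2 * P^ (suc r) * legendreMoment) + P * P * P * closedForm r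
                                                                          ≡⟨ cong (λ X → P * (P - + 1) * ((P - + 1) * P * (X * X) + + 2 * X * legendreMoment) + P * P * P * closedForm r) (P^-suc r) ⟩
    P * (P - + 1) * ((P - + 1) * P * ((P * P^ r) * (P * P^ r)) + + 2 * (P * P^ r) * legendreMoment) + P * P * P * closedForm r
                                                                          ≡⟨ sym (closedForm-rec r) ⟩
    closedForm (2 ℕ.+ r)                                                  ∎
    where
      open ≡-Reasoning
      U = + unitSquareSum (2 ℕ.+ r)
      T = + squareSum r
      regroup : ∀ P U T → + 2 * P * (P - + 1) * (U + P * P * P * T) ≡ P * (P - + 1) * (+ 2 * U) + P * P * P * (+ 2 * P * (P - + 1) * T)
      regroup = solve-∀

  squareSum-cleared : ∀ r → + squareSum r * (+ 2 * (+ (p ℕ.∸ 1) * P)) ≡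
    ((P^ r - P^ (r / 2)) * (+ (p ℕ.∸ 1) * P) + + 2 * (P^ ((r ℕ.+ 1) / 2) - + 1) * legendreMoment) * P^ r
  squareSum-cleared r = begin
    + squareSum r * (+ 2 * (+ (p ℕ.∸ 1) * P))  ≡⟨ cong (λ k → + squareSum r * (+ 2 * (k * P))) (+[n∸1]≡+n-1 p) ⟩
    + squareSum r * (+ 2 * ((P - + 1) * P))    ≡⟨ regroup (+ squareSum r) P ⟩
    + 2 * P * (P - + 1) * + squareSum r        ≡⟨ 2*p*[p-1]*squareSum r ⟩
    closedForm r                               ≡⟨ factor P (P^ r) (P^ (r / 2)) (P^ ((r ℕ.+ 1) / 2)) legendreMoment ⟩
    ((P^ r - P^ (r / 2)) * ((P - + 1) * P) + + 2 * (P^ ((r ℕ.+ 1) / 2) - + 1) * legendreMoment) * P^ r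
                                                   ≡⟨ cong (λ k → ((P^ r - P^ (r / 2)) * (k * P) + + 2 * (P^ ((r ℕ.+ 1) / 2) - + 1) * legendreMoment) * P^ r) (sym (+[n∸1]≡+n-1 p)) ⟩
    ((P^ r - P^ (r / 2)) * (+ (p ℕ.∸ 1) * P) + + 2 * (P^ ((r ℕ.+ 1) / 2) - + 1) * legendreMoment) * P^ r ∎
    where
      open ≡-Reasoning
      +[n∸1]≡+n-1 : ∀ n .{{_ : NonZero n}} → + (n ℕ.∸ 1) ≡ + n - + 1
      +[n∸1]≡+n-1 (suc n) = refl
      regroup : ∀ T P → T * (+ 2 * ((P - + 1) * P)) ≡ + 2 * P * (P - + 1) * T
      regroup = solve-∀
      factor : ∀ P N F C L → P * (P - + 1) * N * (N - F) + + 2 * N * (C - + 1) * L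
                             ≡ ((N - F) * ((P - + 1) * P) + + 2 * (C - + 1) * L) * N
      factor = solve-∀

open ℤ using (ℤ; +_)
open ℤ-Solver using (solve-∀)

sumℚ-applyUpTo : ∀ n (g : ℕ → ℕ) (f : ℕ → ℚ) → sumℚ (map f (applyUpTo g n)) ≡ ℚΣ.Σ n (f ∘ g)
sumℚ-applyUpTo zero    g f = refl
sumℚ-applyUpTo (suc n) g f = begin
  f (g 0) ℚ.+ sumℚ (map f (applyUpTo (g ∘ suc) n))  ≡⟨ cong (f (g 0) ℚ.+_) (sumℚ-applyUpTo n (g ∘ suc) f) ⟩
  f (g 0) ℚ.+ ℚΣ.Σ n (f ∘ g ∘ suc)                  ≡⟨ cong (ℚ._+ ℚΣ.Σ n (f ∘ g ∘ suc)) (sym (ℚP.+-identityˡ (f (g 0)))) ⟩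
  ℚΣ.Σ 1 (f ∘ g) ℚ.+ ℚΣ.Σ n (f ∘ g ∘ suc)           ≡⟨ sym (ℚΣ.Σ-split 1 n (f ∘ g)) ⟩
  ℚΣ.Σ (suc n) (f ∘ g)                              ∎
  where open ≡-Reasoning

Σ<≡Σ : ∀ n f → Σ< n f ≡ ℚΣ.Σ n f
Σ<≡Σ n f = sumℚ-applyUpTo n id f

toℚᵘ-/ : ∀ i d .{{_ : NonZero d}} → toℚᵘ (i ℚ./ d) ℚᵘ.≃ (i ℚᵘ./ d)
toℚᵘ-/ i (suc d) = ℚP.toℚᵘ-fromℚᵘ (i ℚᵘ./ suc d)

/-+-/ : ∀ i j d .{{_ : NonZero d}} → (i ℚ./ d) ℚ.+ (j ℚ./ d) ≡ (i ℤ.+ j) ℚ./ d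
/-+-/ i j d@(suc _) = ℚP.toℚᵘ-injective (begin
  toℚᵘ (i ℚ./ d ℚ.+ j ℚ./ d)          ≈⟨ ℚP.toℚᵘ-homo-+ (i ℚ./ d) (j ℚ./ d) ⟩
  toℚᵘ (i ℚ./ d) ℚᵘ.+ toℚᵘ (j ℚ./ d)  ≈⟨ ℚᵘP.+-cong (toℚᵘ-/ i d) (toℚᵘ-/ j d) ⟩
  i ℚᵘ./ d ℚᵘ.+ j ℚᵘ./ d              ≈⟨ ℚᵘ.*≡* (trans (common-denominator i j (+ d)) (cong ((i ℤ.+ j) ℤ.*_) (sym (ℤP.pos-* d d)))) ⟩
  (i ℤ.+ j) ℚᵘ./ d                    ≈⟨ ℚᵘP.≃-sym (toℚᵘ-/ (i ℤ.+ j) d) ⟩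
  toℚᵘ ((i ℤ.+ j) ℚ./ d)                 ∎)
  where
    open ℚᵘP.≃-Reasoning
    common-denominator : ∀ i j D → (i ℤ.* D ℤ.+ j ℤ.* D) ℤ.* D ≡ (i ℤ.+ j) ℤ.* (D ℤ.* D)
    common-denominator = solve-∀

Σ-/ : ∀ n (z : ℕ → ℤ) d .{{_ : NonZero d}} → ℚΣ.Σ n (λ i → z i ℚ./ d) ≡ ℤΣ.Σ n z ℚ./ d
Σ-/ n z d = sym (Σ-homo ℤP.+-0-isCommutativeMonoid ℚP.+-0-isCommutativeMonoid
                  (ℚ._/ d) (ℚP.0/n≡0 d) (λ i j → sym (/-+-/ i j d)) n z)

floor-/ : ∀ m d .{{_ : NonZero d}} → ℚ.floor (+ m ℚ./ d) ≡ + (m ℕ./ d)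
floor-/ m d@(suc _) = begin
  ℚ.floor q                  ≡⟨ floor-mkℚ q ⟩
  ℚ.↥ q ℤ./ ℚ.↧ q            ≡⟨ cong (ℤ._/ ℚ.↧ q) ↥q≡a ⟩
  + a ℤ./ ℚ.↧ q              ≡⟨ ℤP.*-identityˡ (+ (a ℕ./ b)) ⟩
  + (a ℕ./ b)                ≡⟨ cong +_ (sym (m*n/o*n≡m/o a g b)) ⟩
  + (a ℕ.* g ℕ./ (b ℕ.* g))  ≡⟨ cong +_ (trans (/-congˡ a*g≡m) (/-congʳ b*g≡d)) ⟩
  + (m ℕ./ d)                ∎
  where
    open ≡-Reasoning
    q = + m ℚ./ d
    -- q is stored in lowest terms, as (m / g) / (d / g).
    g = gcd m d
    instance
      g≢0 : NonZero g
      g≢0 = ℕ.≢-nonZero (gcd[m,n]≢0 m d (inj₂ (λ ())))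
    a = m ℕ./ g
    b = suc (ℚ.denominator-1 q)
    instance
      b*g≢0 : NonZero (b ℕ.* g)
      b*g≢0 = ℕP.m*n≢0 b g
    floor-mkℚ : ∀ q → ℚ.floor q ≡ ℚ.↥ q ℤ./ ℚ.↧ q
    floor-mkℚ (ℚ.mkℚ _ _ _) = refl
    ↥q≡a : ℚ.↥ q ≡ + a
    ↥q≡a = ℚP.↥-mkℚ+ a (d ℕ./ g) {{ℕ.≢-nonZero (n/gcd[m,n]≢0 m d)}}
    a*g≡m : a ℕ.* g ≡ m
    a*g≡m = ℤP.+-injective (trans (ℤP.pos-* a g) (trans (cong (ℤ._* + g) (sym ↥q≡a)) (ℚP.↥-/ (+ m) d)))
    b*g≡d : b ℕ.* g ≡ d
    b*g≡d = ℤP.+-injective (trans (ℤP.pos-* b g) (ℚP.↧-/ (+ m) d))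

/-minus-integer : ∀ i j d .{{_ : NonZero d}} → i ℚ./ d ℚ.- j ℚ./ 1 ≡ (i ℤ.- j ℤ.* + d) ℚ./ d
/-minus-integer i j d@(suc _) = ℚP.toℚᵘ-injective (begin
  toℚᵘ (i ℚ./ d ℚ.- j ℚ./ 1)                ≈⟨ ℚP.toℚᵘ-homo-+ (i ℚ./ d) (ℚ.- (j ℚ./ 1)) ⟩
  toℚᵘ (i ℚ./ d) ℚᵘ.+ toℚᵘ (ℚ.- (j ℚ./ 1))  ≈⟨ ℚᵘP.+-congʳ (toℚᵘ (i ℚ./ d)) (ℚP.toℚᵘ-homo‿- (j ℚ./ 1)) ⟩
  toℚᵘ (i ℚ./ d) ℚᵘ.- toℚᵘ (j ℚ./ 1)        ≈⟨ ℚᵘP.+-cong (toℚᵘ-/ i d) (ℚᵘP.-‿cong (toℚᵘ-/ j 1)) ⟩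
  i ℚᵘ./ d ℚᵘ.- j ℚᵘ./ 1                    ≈⟨ ℚᵘ.*≡* (trans (cross i j (+ d)) (cong ((i ℤ.- j ℤ.* + d) ℤ.*_) (sym (ℤP.pos-* d 1)))) ⟩
  (i ℤ.- j ℤ.* + d) ℚᵘ./ d                  ≈⟨ ℚᵘP.≃-sym (toℚᵘ-/ (i ℤ.- j ℤ.* + d) d) ⟩
  toℚᵘ ((i ℤ.- j ℤ.* + d) ℚ./ d)                 ∎)
  where
    open ℚᵘP.≃-Reasoning
    cross : ∀ i j D → (i ℤ.* + 1 ℤ.+ ℤ.- j ℤ.* D) ℤ.* D ≡ (i ℤ.- j ℤ.* D) ℤ.* (D ℤ.* + 1)
    cross = solve-∀

frac-/ : ∀ m d .{{_ : NonZero d}} → frac (+ m ℚ./ d) ≡ + (m ℕ.% d) ℚ./ d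
frac-/ m d = begin
  + m ℚ./ d ℚ.- ℚ.floor (+ m ℚ./ d) ℚ./ 1  ≡⟨ cong (λ k → + m ℚ./ d ℚ.- k ℚ./ 1) (floor-/ m d) ⟩
  + m ℚ./ d ℚ.- + (m ℕ./ d) ℚ./ 1          ≡⟨ /-minus-integer (+ m) (+ (m ℕ./ d)) d ⟩
  (+ m ℤ.- + (m ℕ./ d) ℤ.* + d) ℚ./ d      ≡⟨ cong (λ i → i ℚ./ d) remainder ⟩
  + (m ℕ.% d) ℚ./ d                        ∎
  where
    open ≡-Reasoning
    remainder : + m ℤ.- + (m ℕ./ d) ℤ.* + d ≡ + (m ℕ.% d)
    remainder = begin
      + m ℤ.- + (m ℕ./ d) ℤ.* + d                                  ≡⟨ cong (λ n → + n ℤ.- + (m ℕ./ d) ℤ.* + d) (m≡m%n+[m/n]*n m d) ⟩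
      + (m ℕ.% d ℕ.+ m ℕ./ d ℕ.* d) ℤ.- + (m ℕ./ d) ℤ.* + d        ≡⟨ cong (ℤ._- + (m ℕ./ d) ℤ.* + d) (trans (ℤP.pos-+ (m ℕ.% d) _) (cong (ℤ._+_ (+ (m ℕ.% d))) (ℤP.pos-* (m ℕ./ d) d))) ⟩
      + (m ℕ.% d) ℤ.+ + (m ℕ./ d) ℤ.* + d ℤ.- + (m ℕ./ d) ℤ.* + d  ≡⟨ cancel (+ (m ℕ.% d)) (+ (m ℕ./ d) ℤ.* + d) ⟩
      + (m ℕ.% d)                                                  ∎
      where
        cancel : ∀ a b → a ℤ.+ b ℤ.- b ≡ a
        cancel = solve-∀

clear-denominators : ∀ (T A B S : ℤ) n k q .{{_ : NonZero n}} .{{_ : NonZero k}} .{{_ : NonZero q}} →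
  T ℤ.* (+ 2 ℤ.* (+ k ℤ.* + q)) ≡ (A ℤ.* (+ k ℤ.* + q) ℤ.+ + 2 ℤ.* B ℤ.* S) ℤ.* + n →
  T ℚ./ n ≡ A ℚ./ 2 ℚ.- (B ℚ./ k) ℚ.* (ℚ.- (S ℚ./ q))
clear-denominators T A B S n@(suc _) k@(suc _) q@(suc _) cleared =
  ℚP.toℚᵘ-injective (ℚᵘP.≃-trans (toℚᵘ-/ T n) (ℚᵘP.≃-trans (ℚᵘ.*≡* cross) (ℚᵘP.≃-sym rhs)))
  where
    rhs : toℚᵘ (A ℚ./ 2 ℚ.- (B ℚ./ k) ℚ.* (ℚ.- (S ℚ./ q))) ℚᵘ.≃ A ℚᵘ./ 2 ℚᵘ.- (B ℚᵘ./ k) ℚᵘ.* (ℚᵘ.- (S ℚᵘ./ q))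
    rhs = begin
      toℚᵘ (A ℚ./ 2 ℚ.- (B ℚ./ k) ℚ.* (ℚ.- (S ℚ./ q)))                ≈⟨ ℚP.toℚᵘ-homo-+ (A ℚ./ 2) _ ⟩
      toℚᵘ (A ℚ./ 2) ℚᵘ.+ toℚᵘ (ℚ.- ((B ℚ./ k) ℚ.* (ℚ.- (S ℚ./ q))))  ≈⟨ ℚᵘP.+-cong (toℚᵘ-/ A 2) (ℚP.toℚᵘ-homo‿- _) ⟩
      A ℚᵘ./ 2 ℚᵘ.- toℚᵘ ((B ℚ./ k) ℚ.* (ℚ.- (S ℚ./ q)))              ≈⟨ ℚᵘP.+-congʳ (A ℚᵘ./ 2) (ℚᵘP.-‿cong (ℚP.toℚᵘ-homo-* (B ℚ./ k) _)) ⟩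
      A ℚᵘ./ 2 ℚᵘ.- toℚᵘ (B ℚ./ k) ℚᵘ.* toℚᵘ (ℚ.- (S ℚ./ q))          ≈⟨ ℚᵘP.+-congʳ (A ℚᵘ./ 2) (ℚᵘP.-‿cong (ℚᵘP.*-cong (toℚᵘ-/ B k) (ℚᵘP.≃-trans (ℚP.toℚᵘ-homo‿- (S ℚ./ q)) (ℚᵘP.-‿cong (toℚᵘ-/ S q))))) ⟩
      A ℚᵘ./ 2 ℚᵘ.- (B ℚᵘ./ k) ℚᵘ.* (ℚᵘ.- (S ℚᵘ./ q))                 ∎
      where open ℚᵘP.≃-Reasoning
    cross : T ℤ.* + (2 ℕ.* (k ℕ.* q)) ≡ (A ℤ.* + (k ℕ.* q) ℤ.+ ℤ.- (B ℤ.* ℤ.- S) ℤ.* + 2) ℤ.* + n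
    cross = begin
      T ℤ.* + (2 ℕ.* (k ℕ.* q))                                    ≡⟨ cong (T ℤ.*_) (trans (ℤP.pos-* 2 (k ℕ.* q)) (cong (+ 2 ℤ.*_) (ℤP.pos-* k q))) ⟩
      T ℤ.* (+ 2 ℤ.* (+ k ℤ.* + q))                                ≡⟨ cleared ⟩
      (A ℤ.* (+ k ℤ.* + q) ℤ.+ + 2 ℤ.* B ℤ.* S) ℤ.* + n            ≡⟨ signs A B S (+ k ℤ.* + q) (+ n) ⟩
      (A ℤ.* (+ k ℤ.* + q) ℤ.+ ℤ.- (B ℤ.* ℤ.- S) ℤ.* + 2) ℤ.* + n  ≡⟨ cong (λ kq → (A ℤ.* kq ℤ.+ ℤ.- (B ℤ.* ℤ.- S) ℤ.* + 2) ℤ.* + n) (sym (ℤP.pos-* k q)) ⟩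
      (A ℤ.* + (k ℕ.* q) ℤ.+ ℤ.- (B ℤ.* ℤ.- S) ℤ.* + 2) ℤ.* + n    ∎
      where
        open ≡-Reasoning
        signs : ∀ A B S KQ N → (A ℤ.* KQ ℤ.+ + 2 ℤ.* B ℤ.* S) ℤ.* N ≡ (A ℤ.* KQ ℤ.+ ℤ.- (B ℤ.* ℤ.- S) ℤ.* + 2) ℤ.* N
        signs = solve-∀

proposition4p3 : (p r : ℕ) → .{{_ : NonZero p}} → .{{_ : NonZero (p ∸ 1)}} → .{{_ : NonZero (p ^ r)}}
    → Prime p → ¬ (p ≡ 2) → 1 ≤ r
    → Σ< (p ^ r) (λ x → frac ((+ (x ℕ.* x)) ℚ./ (p ^ r)))
      ≡ ((+ (p ^ r) ℤ.- + (p ^ (r / 2))) ℚ./ 2)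
        ℚ.- (((+ (p ^ ((r ℕ.+ 1) / 2)) ℤ.- + 1) ℚ./ (p ∸ 1)) ℚ.* hstar p)
-- The identity also holds for r = 0.
proposition4p3 p r {{_}} {{_}} {{p^r≢0}} p-prime p≢2 _ = begin
  Σ< (p ^ r) (λ x → frac (+ (x ℕ.* x) ℚ./ p ^ r))               ≡⟨ Σ<≡Σ (p ^ r) _ ⟩
  ℚΣ.Σ (p ^ r) (λ x → frac (+ (x ℕ.* x) ℚ./ p ^ r))             ≡⟨ ℚΣ.Σ-cong (p ^ r) (λ x _ → frac-/ (x ℕ.* x) (p ^ r) {{p^r≢0}}) ⟩
  ℚΣ.Σ (p ^ r) (λ x → + square%p^ r x ℚ./ p ^ r)                ≡⟨ Σ-/ (p ^ r) (λ x → + square%p^ r x) (p ^ r) ⟩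
  ℤΣ.Σ (p ^ r) (λ x → + square%p^ r x) ℚ./ p ^ r                ≡⟨ cong (ℚ._/ p ^ r) (sym (pos-Σ (p ^ r) (square%p^ r))) ⟩
  + squareSum r ℚ./ p ^ r                                       ≡⟨ clear-denominators (+ squareSum r) A B legendreMoment (p ^ r) (p ∸ 1) p (squareSum-cleared r) ⟩
  A ℚ./ 2 ℚ.- (B ℚ./ (p ∸ 1)) ℚ.* (ℚ.- (legendreMoment ℚ./ p))  ≡⟨ cong (λ h → A ℚ./ 2 ℚ.- (B ℚ./ (p ∸ 1)) ℚ.* h) (sym hstar≡) ⟩
  A ℚ./ 2 ℚ.- (B ℚ./ (p ∸ 1)) ℚ.* hstar p                       ∎
  where
    open ≡-Reasoning
    A = + (p ^ r) ℤ.- + (p ^ (r / 2))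
    B = + (p ^ ((r ℕ.+ 1) / 2)) ℤ.- + 1
    open PrimePowerSquareSums p-prime p≢2 using (square%p^; squareSum)
    open ClosedForm p-prime p≢2 using (legendreMoment; squareSum-cleared)
    hstar≡ : hstar p ≡ ℚ.- (legendreMoment ℚ./ p)
    hstar≡ = cong ℚ.-_ (trans (Σ<≡Σ p _) (Σ-/ p _ p))
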